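{- For every $n\ge1$ there exists a bijection between the set of $2\times n$ Nurikabe grids and the set of strings appearing in the list $\mathbb{S}(n)$ (defined in the context).
   Context: A $2\times n$ Nurikabe grid is a black/white coloring of the cells of a $2\times n$ grid such that the black cells are edge-connected (possibly empty) and no $2\times 2$ subgrid is entirely black. The list $\mathbb{S}(n)$ of strings over $\{0,1,2,3\}$ of length $n$ is defined as follows. Set $\mathbb{S}(1)=\mathrm{core}(1)=0,1,2,3$. For $n\ge2$, set $\mathbb{S}(n)=0\cdot\mathbb{S}(n-1),\ \mathrm{core}(n)[1:]$, where $$\mathrm{core}(n)=03^{n-1},\ 1\cdot\overleftarrow{\mathrm{core}(n-1)},\ 2\cdot\mathrm{core}(n-1),\ 3^n.$$ Here $d\cdot L$ prefixes digit $d$ to every string of list $L$, $\overleftarrow{L}$ is the reversed list, commas denote concatenation, exponents denote repetition, and $L[1:]$ is $L$ with its first element removed. The strings of $\mathbb{S}(n)$ are exactly the states on the shortest solution of a Ziggu puzzle with $n$ digits. -}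

module Defs where

open import Data.Nat using (ℕ; zero; suc)
open import Data.Fin using (Fin; toℕ) renaming (zero to f0; suc to fs)
open import Data.Bool using (Bool; true; false)
open import Data.Product using (_×_; _,_; proj₁; proj₂)
open import Data.Sum using (_⊎_)
open import Data.Vec using (Vec; []; _∷_; lookup; replicate)
open import Data.List using (List; []; _∷_; _++_; map; reverse; drop)
open import Data.List.Membership.Propositional using (_∈_)
open import Relation.Binary.PropositionalEquality using (_≡_)
open import Relation.Binary.Construct.Closure.ReflexiveTransitive using (Star)
open import Relation.Nullary using (¬_)
open import Data.Refinement using (Refinement)

-- 2 × n grids: a vector of n columns, each column a (top , bottom) pair
-- of Booleans; true = black, false = white.

Grid : ℕ → Set
Grid n = Vec (Bool × Bool) n

-- a cell: (row , column), row ∈ Fin 2 (0 = top, 1 = bottom)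
Cell : ℕ → Set
Cell n = Fin 2 × Fin n

colour : ∀ {n} → Grid n → Cell n → Bool
colour g (f0 , j)    = proj₁ (lookup g j)
colour g (fs _ , j)  = proj₂ (lookup g j)

Black : ∀ {n} → Grid n → Cell n → Set
Black g c = colour g c ≡ true

Adj : ∀ {n} → Cell n → Cell n → Set
Adj (r , j) (r' , j') =
  (r ≡ r' × (toℕ j' ≡ suc (toℕ j) ⊎ toℕ j ≡ suc (toℕ j')))
  ⊎ (j ≡ j' × ¬ (r ≡ r'))

BlackStep : ∀ {n} → Grid n → Cell n → Cell n → Set
BlackStep g c d = Adj c d × Black g c × Black g d

-- black cells are edge-connected (vacuous if there are no black cells)
BlackConnected : ∀ {n} → Grid n → Set
BlackConnected {n} g =
  (c d : Cell n) → Black g c → Black g d → Star (BlackStep g) c d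

No2x2Black : ∀ {n} → Grid n → Set
No2x2Black {n} g = (j k : Fin n) → toℕ k ≡ suc (toℕ j) →
  ¬ (Black g (f0 , j) × Black g (fs f0 , j) ×
     Black g (f0 , k) × Black g (fs f0 , k))

IsNurikabe : ∀ {n} → Grid n → Set
IsNurikabe g = BlackConnected g × No2x2Black g

NurikabeGrid : ℕ → Set
NurikabeGrid n = Refinement (Grid n) IsNurikabe

Str : ℕ → Set
Str n = Vec (Fin 4) n

d0 d1 d2 d3 : Fin 4
d0 = f0
d1 = fs f0
d2 = fs (fs f0)
d3 = fs (fs (fs f0))

_·_ : ∀ {n} → Fin 4 → List (Str n) → List (Str (suc n))
d · L = map (d ∷_) L

-- core(m+1), for m ≥ 0
core : (m : ℕ) → List (Str (suc m))
core zero    = (d0 ∷ []) ∷ (d1 ∷ []) ∷ (d2 ∷ []) ∷ (d3 ∷ []) ∷ []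
core (suc m) =
  ((d0 ∷ replicate (suc m) d3) ∷ [])
  ++ (d1 · reverse (core m))
  ++ (d2 · core m)
  ++ (replicate (suc (suc m)) d3 ∷ [])

-- 𝕊(m+1), for m ≥ 0
𝕊 : (m : ℕ) → List (Str (suc m))
𝕊 zero    = core zero
𝕊 (suc m) = (d0 · 𝕊 m) ++ drop 1 (core (suc m))

𝕊Set : ℕ → Set
𝕊Set m = Refinement (Str (suc m)) (_∈ 𝕊 m)

-- A 2×n grid is Nurikabe iff it consists of empty columns, then a run of
-- non-empty columns in which consecutive columns share a black row and are not
-- both full, then empty columns: a black path can neither cross an empty column
-- nor pass between consecutive columns without a common black row. In such a
-- run every column is determined by its successor and the choice of one of its
-- black rows (linkColumn), except a full last column. Writing 1 or 2 for that
-- row, and 0 and 3 for an empty column and a full last column (their roles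
-- swapped after the first black column), turns this description of Nurikabe
-- grids into the recursive description of 𝕊(n) and core(n); the order of the
-- lists, including the reversal in core, is irrelevant for membership.
module Submission where

open import Defs
open import Data.Nat using (ℕ; zero; suc; _≤_; _<_; z≤n; s≤s)
open import Data.Nat.Properties using (suc-injective; 1+n≰n; m≤n⇒m<n∨m≡n; n≤1+n; <⇒≤; ≤-trans; ≤-refl; ≤-reflexive)
open import Data.Fin using (Fin; toℕ) renaming (zero to f0; suc to fs)
open import Data.Fin.Properties using (toℕ-injective) renaming (_≟_ to _≟ᶠ_)
open import Data.Bool using (Bool; true; false) renaming (_≟_ to _≟ᵇ_)
open import Data.Product using (_×_; _,_; proj₁; proj₂; Σ; ∃; map₁)
open import Data.Product.Properties using () renaming (≡-dec to ×-≡-dec)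
open import Data.Sum using (_⊎_; inj₁; inj₂)
open import Data.Empty using (⊥; ⊥-elim)
open import Data.Vec using ([]; _∷_; lookup; replicate)
open import Data.Vec.Properties using () renaming (≡-dec to vec-≡-dec)
open import Data.Vec.Relation.Unary.All using (All; []; _∷_)
open import Data.Vec.Relation.Unary.All.Properties using (lookup⁺; lookup⁻)
open import Data.List using (reverse; drop)
open import Data.List.Membership.Propositional using (_∈_)
open import Data.List.Membership.Propositional.Properties using (∈-map⁺; ∈-map⁻; ∈-++⁺ˡ; ∈-++⁺ʳ; ∈-++⁻)
open import Data.List.Relation.Unary.Any using (here; there)
open import Data.List.Relation.Unary.Any.Properties using (reverse⁺; reverse⁻)
open import Relation.Binary.PropositionalEquality using (_≡_; refl; sym; trans; cong; cong₂; subst; module ≡-Reasoning)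
open import Relation.Binary.Construct.Closure.ReflexiveTransitive using (Star; ε; _◅_; _◅◅_; gmap) renaming (reverse to Star-reverse)
open import Relation.Nullary.Decidable.Core using (recompute)
open import Data.Irrelevant using ([_])
open import Data.Refinement using (_,_; value-injective)
open import Function.Bundles using (_⤖_; mk↔ₛ′)
open import Function.Properties.Inverse using (↔⇒⤖)

variable
  n : ℕ

-- The grammar of core and 𝕊

rowDigit : Fin 2 → Fin 4
rowDigit f0     = d1
rowDigit (fs _) = d2

-- InCore n, CoreTail n and In𝕊 n describe core(n), core(n+1)[1:] and 𝕊(n),
-- with core(0) = 𝕊(0) = ε; Defs indexes core and 𝕊 by n − 1.
mutual
  data InCore : (n : ℕ) → Str n → Set where
    []   : InCore 0 []
    0∷3s : InCore (suc n) (d0 ∷ replicate n d3)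
    tail : ∀ {t} → CoreTail n t → InCore (suc n) t

  data CoreTail : (n : ℕ) → Str (suc n) → Set where
    row∷ : ∀ r {t} → InCore n t → CoreTail n (rowDigit r ∷ t)
    3s   : CoreTail n (replicate (suc n) d3)

data In𝕊 : (n : ℕ) → Str n → Set where
  []   : In𝕊 0 []
  0∷_  : ∀ {t} → In𝕊 n t → In𝕊 (suc n) (d0 ∷ t)
  tail : ∀ {t} → CoreTail n t → In𝕊 (suc n) t

threes-InCore : ∀ n → InCore n (replicate n d3)
threes-InCore zero    = []
threes-InCore (suc n) = tail 3s

mutual
  ∈core⇒InCore : ∀ m {t} → t ∈ core m → InCore (suc m) t
  ∈core⇒InCore zero (here refl)                         = 0∷3s
  ∈core⇒InCore zero (there (here refl))                 = tail (row∷ f0 [])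
  ∈core⇒InCore zero (there (there (here refl)))         = tail (row∷ (fs f0) [])
  ∈core⇒InCore zero (there (there (there (here refl)))) = tail 3s
  ∈core⇒InCore (suc m) (here refl) = 0∷3s
  ∈core⇒InCore (suc m) (there p)   = tail (∈coreTail⇒CoreTail m p)

  ∈coreTail⇒CoreTail : ∀ m {t} → t ∈ drop 1 (core (suc m)) → CoreTail (suc m) t
  ∈coreTail⇒CoreTail m p with ∈-++⁻ (d1 · reverse (core m)) p
  ... | inj₁ p₁ with ∈-map⁻ (d1 ∷_) p₁
  ...   | _ , u∈ , refl = row∷ f0 (∈core⇒InCore m (reverse⁻ u∈))
  ∈coreTail⇒CoreTail m p | inj₂ p₂ with ∈-++⁻ (d2 · core m) p₂
  ... | inj₁ p₃ with ∈-map⁻ (d2 ∷_) p₃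
  ...   | _ , u∈ , refl = row∷ (fs f0) (∈core⇒InCore m u∈)
  ∈coreTail⇒CoreTail m p | inj₂ p₂ | inj₂ (here refl) = 3s

mutual
  InCore⇒∈core : ∀ m {t} → InCore (suc m) t → t ∈ core m
  InCore⇒∈core zero 0∷3s                     = here refl
  InCore⇒∈core zero (tail (row∷ f0 []))      = there (here refl)
  InCore⇒∈core zero (tail (row∷ (fs f0) [])) = there (there (here refl))
  InCore⇒∈core zero (tail 3s)                = there (there (there (here refl)))
  InCore⇒∈core (suc m) 0∷3s     = here refl
  InCore⇒∈core (suc m) (tail c) = there (CoreTail⇒∈coreTail m c)

  CoreTail⇒∈coreTail : ∀ m {t} → CoreTail (suc m) t → t ∈ drop 1 (core (suc m))
  CoreTail⇒∈coreTail m (row∷ f0 c) =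
    ∈-++⁺ˡ (∈-map⁺ (d1 ∷_) (reverse⁺ (InCore⇒∈core m c)))
  CoreTail⇒∈coreTail m (row∷ (fs f0) c) =
    ∈-++⁺ʳ (d1 · reverse (core m)) (∈-++⁺ˡ (∈-map⁺ (d2 ∷_) (InCore⇒∈core m c)))
  CoreTail⇒∈coreTail m 3s =
    ∈-++⁺ʳ (d1 · reverse (core m)) (∈-++⁺ʳ (d2 · core m) (here refl))

∈𝕊⇒In𝕊 : ∀ m {t} → t ∈ 𝕊 m → In𝕊 (suc m) t
∈𝕊⇒In𝕊 zero (here refl)                         = 0∷ []
∈𝕊⇒In𝕊 zero (there (here refl))                 = tail (row∷ f0 [])
∈𝕊⇒In𝕊 zero (there (there (here refl)))         = tail (row∷ (fs f0) [])
∈𝕊⇒In𝕊 zero (there (there (there (here refl)))) = tail 3s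
∈𝕊⇒In𝕊 (suc m) p with ∈-++⁻ (d0 · 𝕊 m) p
... | inj₁ p₀ with ∈-map⁻ (d0 ∷_) p₀
...   | _ , u∈ , refl = 0∷ ∈𝕊⇒In𝕊 m u∈
∈𝕊⇒In𝕊 (suc m) p | inj₂ p₁ = tail (∈coreTail⇒CoreTail m p₁)

In𝕊⇒∈𝕊 : ∀ m {t} → In𝕊 (suc m) t → t ∈ 𝕊 m
In𝕊⇒∈𝕊 zero (0∷ [])                   = here refl
In𝕊⇒∈𝕊 zero (tail (row∷ f0 []))      = there (here refl)
In𝕊⇒∈𝕊 zero (tail (row∷ (fs f0) [])) = there (there (here refl))
In𝕊⇒∈𝕊 zero (tail 3s)                = there (there (there (here refl)))
In𝕊⇒∈𝕊 (suc m) (0∷ s)   = ∈-++⁺ˡ (∈-map⁺ (d0 ∷_) (In𝕊⇒∈𝕊 m s))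
In𝕊⇒∈𝕊 (suc m) (tail c) = ∈-++⁺ʳ (d0 · 𝕊 m) (CoreTail⇒∈coreTail m c)

-- Nurikabe shapes

Col : Set
Col = Bool × Bool

pattern empty  = (false , false)
pattern top    = (true , false)
pattern bottom = (false , true)
pattern full   = (true , true)

variable
  x y : Col
  g : Grid n

data NonEmpty : Col → Set where
  ne-top    : NonEmpty top
  ne-bottom : NonEmpty bottom
  ne-full   : NonEmpty full

nonEmpty? : ∀ x → x ≡ empty ⊎ NonEmpty x
nonEmpty? empty  = inj₁ refl
nonEmpty? top    = inj₂ ne-top
nonEmpty? bottom = inj₂ ne-bottom
nonEmpty? full   = inj₂ ne-full

-- The column whose row r is black, together with the other row exactly when
-- that is needed to share a black row with the next column y.
linkColumn : Fin 2 → Col → Col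
linkColumn f0     bottom = full
linkColumn f0     _      = top
linkColumn (fs _) top    = full
linkColumn (fs _) _      = bottom

linkColumn-nonEmpty : ∀ r y → NonEmpty (linkColumn r y)
linkColumn-nonEmpty f0      empty  = ne-top
linkColumn-nonEmpty f0      top    = ne-top
linkColumn-nonEmpty f0      bottom = ne-full
linkColumn-nonEmpty f0      full   = ne-top
linkColumn-nonEmpty (fs f0) empty  = ne-bottom
linkColumn-nonEmpty (fs f0) top    = ne-full
linkColumn-nonEmpty (fs f0) bottom = ne-bottom
linkColumn-nonEmpty (fs f0) full   = ne-bottom

-- For non-empty x and y this says that x and y share a black row and are not both full.
Linked : Col → Col → Set
Linked x y = ∃ λ r → linkColumn r y ≡ x

AllEmpty : Grid n → Set
AllEmpty = All (_≡ empty)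

firstColumn : Grid n → Col
firstColumn []      = empty
firstColumn (x ∷ _) = x

-- Strip x g: the columns x ∷ g are a run of linked non-empty columns followed by empty ones.
mutual
  data Strip : Col → Grid n → Set where
    fullEnd : AllEmpty g → Strip full g
    link    : ∀ r → EmptyOrStrip g → Strip (linkColumn r (firstColumn g)) g

  data EmptyOrStrip : Grid n → Set where
    blanks : AllEmpty g → EmptyOrStrip g
    strip  : Strip x g → EmptyOrStrip (x ∷ g)

data NurikabeShape : Grid n → Set where
  []      : NurikabeShape []
  blank∷_ : NurikabeShape g → NurikabeShape (empty ∷ g)
  strip   : Strip x g → NurikabeShape (x ∷ g)

strip-nonEmpty : Strip x g → NonEmpty x
strip-nonEmpty (fullEnd _)        = ne-full
strip-nonEmpty (link {g = g} r _) = linkColumn-nonEmpty r (firstColumn g)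

firstColumn-allEmpty : AllEmpty g → firstColumn g ≡ empty
firstColumn-allEmpty []      = refl
firstColumn-allEmpty (e ∷ _) = e

allEmpty-replicate : ∀ n → AllEmpty (replicate n empty)
allEmpty-replicate zero    = []
allEmpty-replicate (suc n) = refl ∷ allEmpty-replicate n

allEmpty⇒replicate : AllEmpty g → g ≡ replicate n empty
allEmpty⇒replicate []         = refl
allEmpty⇒replicate (refl ∷ a) = cong (empty ∷_) (allEmpty⇒replicate a)

allEmpty-shape : AllEmpty g → NurikabeShape g
allEmpty-shape []         = []
allEmpty-shape (refl ∷ a) = blank∷ allEmpty-shape a

-- Encoding and decoding

-- An empty column is 0 before the first black column and 3 after it, a full
-- column followed by an empty one the other way round; every other column x
-- followed by y is the digit of the row r with x = linkColumn r y (full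
-- followed by full never occurs).
digit : Bool → Col → Col → Fin 4
digit _     top    _      = d1
digit _     bottom _      = d2
digit _     full   top    = d2
digit _     full   bottom = d1
digit _     full   full   = d1
digit false full   empty  = d3
digit true  full   empty  = d0
digit false empty  _      = d0
digit true  empty  _      = d3

seenAfter : Bool → Col → Bool
seenAfter seen empty = seen
seenAfter _    _     = true

encode : Bool → Grid n → Str n
encode _    []      = []
encode seen (x ∷ g) = digit seen x (firstColumn g) ∷ encode (seenAfter seen x) g

decode : Bool → Str n → Grid n
decode _     []                     = []
decode _     (fs f0 ∷ s)            = linkColumn f0 (firstColumn (decode true s)) ∷ decode true s
decode _     (fs (fs f0) ∷ s)       = linkColumn (fs f0) (firstColumn (decode true s)) ∷ decode true s
decode false (f0 ∷ s)               = empty ∷ decode false s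
decode true  (f0 ∷ _)               = full ∷ replicate _ empty
decode false (fs (fs (fs f0)) ∷ _)  = full ∷ replicate _ empty
decode true  (fs (fs (fs f0)) ∷ _)  = empty ∷ replicate _ empty

digit-linkColumn : ∀ seen r y → digit seen (linkColumn r y) y ≡ rowDigit r
digit-linkColumn _ f0      empty  = refl
digit-linkColumn _ f0      top    = refl
digit-linkColumn _ f0      bottom = refl
digit-linkColumn _ f0      full   = refl
digit-linkColumn _ (fs f0) empty  = refl
digit-linkColumn _ (fs f0) top    = refl
digit-linkColumn _ (fs f0) bottom = refl
digit-linkColumn _ (fs f0) full   = refl

seenAfter-nonEmpty : ∀ seen → NonEmpty x → seenAfter seen x ≡ true
seenAfter-nonEmpty _ ne-top    = refl
seenAfter-nonEmpty _ ne-bottom = refl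
seenAfter-nonEmpty _ ne-full   = refl

encode-row : ∀ seen r (g : Grid n) →
  encode seen (linkColumn r (firstColumn g) ∷ g) ≡ rowDigit r ∷ encode true g
encode-row seen r g =
  cong₂ _∷_ (digit-linkColumn seen r (firstColumn g))
            (cong (λ s → encode s g) (seenAfter-nonEmpty seen (linkColumn-nonEmpty r (firstColumn g))))

encode-allEmpty : AllEmpty g → encode true g ≡ replicate n d3
encode-allEmpty []         = refl
encode-allEmpty (refl ∷ a) = cong (d3 ∷_) (encode-allEmpty a)

encode-fullEnd : ∀ seen → AllEmpty g → encode seen (full ∷ g) ≡ digit seen full empty ∷ replicate n d3
encode-fullEnd seen a rewrite firstColumn-allEmpty a = cong (digit seen full empty ∷_) (encode-allEmpty a)

decode-rowDigit : ∀ seen r (s : Str n) →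
  decode seen (rowDigit r ∷ s) ≡ linkColumn r (firstColumn (decode true s)) ∷ decode true s
decode-rowDigit _ f0      _ = refl
decode-rowDigit _ (fs f0) _ = refl

decode-fullEnd : ∀ seen n → decode seen (digit seen full empty ∷ replicate n d3) ≡ full ∷ replicate n empty
decode-fullEnd false _ = refl
decode-fullEnd true  _ = refl

decode-threes : ∀ n → decode true (replicate n d3) ≡ replicate n empty
decode-threes zero    = refl
decode-threes (suc n) = refl

mutual
  encode-strip : Strip x g → InCore (suc n) (encode true (x ∷ g))
  encode-strip (fullEnd a) = subst (InCore _) (sym (encode-fullEnd true a)) 0∷3s
  encode-strip (link r e)  = tail (encode-link true r e)

  encode-emptyOrStrip : EmptyOrStrip g → InCore n (encode true g)
  encode-emptyOrStrip (blanks a) = subst (InCore _) (sym (encode-allEmpty a)) (threes-InCore _)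
  encode-emptyOrStrip (strip s)  = encode-strip s

  encode-link : ∀ seen r → EmptyOrStrip g → CoreTail n (encode seen (linkColumn r (firstColumn g) ∷ g))
  encode-link {g = g} seen r e = subst (CoreTail _) (sym (encode-row seen r g)) (row∷ r (encode-emptyOrStrip e))

encode-shape : NurikabeShape g → In𝕊 n (encode false g)
encode-shape []                  = []
encode-shape (blank∷ s)          = 0∷ encode-shape s
encode-shape (strip (fullEnd a)) = subst (In𝕊 _) (sym (encode-fullEnd false a)) (tail 3s)
encode-shape (strip (link r e))  = tail (encode-link false r e)

mutual
  decode-strip : ∀ seen → Strip x g → decode seen (encode seen (x ∷ g)) ≡ x ∷ g
  decode-strip {g = g} seen (fullEnd a) = begin
    decode seen (encode seen (full ∷ g))                 ≡⟨ cong (decode seen) (encode-fullEnd seen a) ⟩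
    decode seen (digit seen full empty ∷ replicate _ d3) ≡⟨ decode-fullEnd seen _ ⟩
    full ∷ replicate _ empty                             ≡⟨ cong (full ∷_) (sym (allEmpty⇒replicate a)) ⟩
    full ∷ g                                             ∎
    where open ≡-Reasoning
  decode-strip {g = g} seen (link r e) = begin
    decode seen (encode seen (linkColumn r (firstColumn g) ∷ g)) ≡⟨ cong (decode seen) (encode-row seen r g) ⟩
    decode seen (rowDigit r ∷ encode true g)                     ≡⟨ decode-rowDigit seen r _ ⟩
    linkColumn r (firstColumn (decode true (encode true g))) ∷ decode true (encode true g)
      ≡⟨ cong (λ h → linkColumn r (firstColumn h) ∷ h) (decode-emptyOrStrip e) ⟩
    linkColumn r (firstColumn g) ∷ g                             ∎
    where open ≡-Reasoning

  decode-emptyOrStrip : ∀ {n} {g : Grid n} → EmptyOrStrip g → decode true (encode true g) ≡ g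
  decode-emptyOrStrip {n} (blanks a) = begin
    decode true (encode true _)  ≡⟨ cong (decode true) (encode-allEmpty a) ⟩
    decode true (replicate n d3) ≡⟨ decode-threes n ⟩
    replicate n empty            ≡⟨ sym (allEmpty⇒replicate a) ⟩
    _                            ∎
    where open ≡-Reasoning
  decode-emptyOrStrip (strip s) = decode-strip true s

decode-shape : NurikabeShape g → decode false (encode false g) ≡ g
decode-shape []         = refl
decode-shape (blank∷ s) = cong (empty ∷_) (decode-shape s)
decode-shape (strip s)  = decode-strip false s

mutual
  decode-inCore : ∀ {t} → InCore n t → EmptyOrStrip (decode true t) × encode true (decode true t) ≡ t
  decode-inCore []                       = blanks [] , refl
  decode-inCore {suc n} 0∷3s             =
    strip (fullEnd (allEmpty-replicate n)) , encode-fullEnd true (allEmpty-replicate n)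
  decode-inCore (tail (row∷ f0 c))       = map₁ strip (decode-row true f0 c)
  decode-inCore (tail (row∷ (fs f0) c))  = map₁ strip (decode-row true (fs f0) c)
  decode-inCore {suc n} (tail 3s)        =
    blanks (allEmpty-replicate (suc n)) , cong (d3 ∷_) (encode-allEmpty (allEmpty-replicate n))

  decode-row : ∀ seen r {t} → InCore n t →
    let g = decode true t in
    Strip (linkColumn r (firstColumn g)) g × encode seen (linkColumn r (firstColumn g) ∷ g) ≡ rowDigit r ∷ t
  decode-row seen r c with decode-inCore c
  ... | e , eq = link r e , trans (encode-row seen r _) (cong (rowDigit r ∷_) eq)

decode-in𝕊 : ∀ {t} → In𝕊 n t → NurikabeShape (decode false t) × encode false (decode false t) ≡ t
decode-in𝕊 []                      = [] , refl
decode-in𝕊 (0∷ s) with decode-in𝕊 s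
... | shape , eq                   = blank∷ shape , cong (d0 ∷_) eq
decode-in𝕊 (tail (row∷ f0 c))      = map₁ strip (decode-row false f0 c)
decode-in𝕊 (tail (row∷ (fs f0) c)) = map₁ strip (decode-row false (fs f0) c)
decode-in𝕊 {suc n} (tail 3s)       =
  strip (fullEnd (allEmpty-replicate n)) , encode-fullEnd false (allEmpty-replicate n)

-- Nurikabe grids are the grids of Nurikabe shape

rowColour : Fin 2 → Col → Bool
rowColour f0     = proj₁
rowColour (fs _) = proj₂

Black-lookup : ∀ (g : Grid n) r j → Black g (r , j) → rowColour r (lookup g j) ≡ true
Black-lookup g f0     j b = b
Black-lookup g (fs _) j b = b

lookup-Black : ∀ (g : Grid n) r j → rowColour r (lookup g j) ≡ true → Black g (r , j)
lookup-Black g f0     j b = b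
lookup-Black g (fs _) j b = b

empty-white : ∀ r → rowColour r empty ≡ true → ⊥
empty-white f0     ()
empty-white (fs _) ()

RowDisjoint : Col → Col → Set
RowDisjoint x y = ∀ r → rowColour r x ≡ true → rowColour r y ≡ true → ⊥

NoCrossing : Grid n → ℕ → Set
NoCrossing {n} g t = ∀ (j k : Fin n) → toℕ j ≡ t → toℕ k ≡ suc t → RowDisjoint (lookup g j) (lookup g k)

noCrossing-at : ∀ (j : Fin n) →
  (∀ k → toℕ k ≡ suc (toℕ j) → RowDisjoint (lookup g j) (lookup g k)) → NoCrossing g (toℕ j)
noCrossing-at j disjoint j′ k j′≡j k≡1+j with toℕ-injective j′≡j
... | refl = disjoint k k≡1+j

-- A black path crosses from column t to column t + 1 only along a row black in both.
blackPath-stays-≤ : ∀ {t} → NoCrossing g t → ∀ {c d} → Star (BlackStep g) c d →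
  toℕ (proj₂ c) ≤ t → toℕ (proj₂ d) ≤ t
blackPath-stays-≤ noCross ε c≤t = c≤t
blackPath-stays-≤ {g = g} {t} noCross {r , j} ((inj₁ (refl , inj₁ j′≡1+j) , bc , bd) ◅ path) j≤t
  with m≤n⇒m<n∨m≡n j≤t
... | inj₁ j<t = blackPath-stays-≤ noCross path (subst (_≤ t) (sym j′≡1+j) j<t)
... | inj₂ j≡t =
  ⊥-elim (noCross j _ j≡t (trans j′≡1+j (cong suc j≡t)) r (Black-lookup g r j bc) (Black-lookup g r _ bd))
blackPath-stays-≤ {t = t} noCross ((inj₁ (refl , inj₂ j≡1+j′) , _) ◅ path) j≤t =
  blackPath-stays-≤ noCross path (≤-trans (n≤1+n _) (subst (_≤ t) j≡1+j′ j≤t))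
blackPath-stays-≤ noCross ((inj₂ (refl , _) , _) ◅ path) j≤t = blackPath-stays-≤ noCross path j≤t

blackRow : NonEmpty x → Σ (Fin 2) λ r → rowColour r x ≡ true
blackRow ne-top    = f0 , refl
blackRow ne-bottom = fs f0 , refl
blackRow ne-full   = f0 , refl

separated : BlackConnected g → ∀ {t} → NoCrossing g t → ∀ i k → toℕ i ≤ t → t < toℕ k →
  NonEmpty (lookup g i) → NonEmpty (lookup g k) → ⊥
separated {g = g} connected noCross i k i≤t t<k nei nek
  with blackRow nei | blackRow nek
... | ri , bi | rk , bk =
  1+n≰n (≤-trans t<k (blackPath-stays-≤ noCross path i≤t))
  where
  path : Star (BlackStep g) (ri , i) (rk , k)
  path = connected (ri , i) (rk , k) (lookup-Black g ri i bi) (lookup-Black g rk k bk)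

linked-or-blocked : NonEmpty x → NonEmpty y → Linked x y ⊎ (x ≡ full × y ≡ full) ⊎ RowDisjoint x y
linked-or-blocked ne-top    ne-top    = inj₁ (f0 , refl)
linked-or-blocked ne-top    ne-full   = inj₁ (f0 , refl)
linked-or-blocked ne-bottom ne-bottom = inj₁ (fs f0 , refl)
linked-or-blocked ne-bottom ne-full   = inj₁ (fs f0 , refl)
linked-or-blocked ne-full   ne-top    = inj₁ (fs f0 , refl)
linked-or-blocked ne-full   ne-bottom = inj₁ (f0 , refl)
linked-or-blocked ne-full   ne-full   = inj₂ (inj₁ (refl , refl))
linked-or-blocked ne-top    ne-bottom = inj₂ (inj₂ λ { f0 _ () ; (fs _) () _ })
linked-or-blocked ne-bottom ne-top    = inj₂ (inj₂ λ { f0 () _ ; (fs _) _ () })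

LinkedNeighbours : Grid n → Set
LinkedNeighbours {n} g = ∀ (j k : Fin n) → toℕ k ≡ suc (toℕ j) →
  NonEmpty (lookup g j) → NonEmpty (lookup g k) → Linked (lookup g j) (lookup g k)

Gapless : Grid n → Set
Gapless {n} g = ∀ (i j k : Fin n) → toℕ i < toℕ j → toℕ j < toℕ k →
  NonEmpty (lookup g i) → lookup g j ≡ empty → lookup g k ≡ empty

nurikabe⇒linkedNeighbours : IsNurikabe g → LinkedNeighbours g
nurikabe⇒linkedNeighbours {g = g} (connected , no2x2) j k k≡1+j nej nek with linked-or-blocked nej nek
... | inj₁ linked = linked
... | inj₂ (inj₁ (j-full , k-full)) =
  ⊥-elim (no2x2 j k k≡1+j (cong proj₁ j-full , cong proj₂ j-full , cong proj₁ k-full , cong proj₂ k-full))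
... | inj₂ (inj₂ disjoint) =
  ⊥-elim (separated connected (noCrossing-at {g = g} j disjoint′) j k ≤-refl (≤-reflexive (sym k≡1+j)) nej nek)
  where
  disjoint′ : ∀ k′ → toℕ k′ ≡ suc (toℕ j) → RowDisjoint (lookup g j) (lookup g k′)
  disjoint′ k′ k′≡1+j = subst (λ l → RowDisjoint (lookup g j) (lookup g l))
                              (toℕ-injective (trans k≡1+j (sym k′≡1+j))) disjoint

nurikabe⇒gapless : IsNurikabe g → Gapless g
nurikabe⇒gapless {g = g} (connected , _) i j k i<j j<k nei j-empty with nonEmpty? (lookup g k)
... | inj₁ k-empty = k-empty
... | inj₂ nek =
  ⊥-elim (separated connected (noCrossing-at {g = g} j blank-column) i k (<⇒≤ i<j) j<k nei nek)
  where
  blank-column : ∀ k′ → toℕ k′ ≡ suc (toℕ j) → RowDisjoint (lookup g j) (lookup g k′)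
  blank-column _ _ r bj _ = empty-white r (subst (λ x → rowColour r x ≡ true) j-empty bj)

linkedNeighbours-tail : LinkedNeighbours (x ∷ g) → LinkedNeighbours g
linkedNeighbours-tail linked j k e = linked (fs j) (fs k) (cong suc e)

gapless-tail : Gapless (x ∷ g) → Gapless g
gapless-tail gapless i j k i<j j<k = gapless (fs i) (fs j) (fs k) (s≤s i<j) (s≤s j<k)

halfEnd : ∀ r → AllEmpty g → Strip (linkColumn r empty) g
halfEnd r a = subst (λ y → Strip (linkColumn r y) _) (firstColumn-allEmpty a) (link r (blanks a))

endStrip : NonEmpty x → AllEmpty g → Strip x g
endStrip ne-top    = halfEnd f0
endStrip ne-bottom = halfEnd (fs f0)
endStrip ne-full   = fullEnd

strip-from : ∀ (g : Grid n) → NonEmpty x → LinkedNeighbours (x ∷ g) → Gapless (x ∷ g) → Strip x g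
strip-from [] nex _ _ = endStrip nex []
strip-from (y ∷ g) nex linked gapless with nonEmpty? y
... | inj₁ refl =
  endStrip nex (refl ∷ lookup⁻ λ k → gapless f0 (fs f0) (fs (fs k)) (s≤s z≤n) (s≤s (s≤s z≤n)) nex refl)
... | inj₂ ney with linked f0 (fs f0) refl nex ney
...   | r , refl =
  link r (strip (strip-from g ney (linkedNeighbours-tail linked) (gapless-tail gapless)))

shape-from : ∀ (g : Grid n) → LinkedNeighbours g → Gapless g → NurikabeShape g
shape-from [] _ _ = []
shape-from (x ∷ g) linked gapless with nonEmpty? x
... | inj₁ refl = blank∷ shape-from g (linkedNeighbours-tail linked) (gapless-tail gapless)
... | inj₂ nex  = strip (strip-from g nex linked gapless)

nurikabe⇒shape : IsNurikabe g → NurikabeShape g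
nurikabe⇒shape {g = g} p = shape-from g (nurikabe⇒linkedNeighbours p) (nurikabe⇒gapless p)

anchor : Col → Fin 2
anchor (true , _)  = f0
anchor (false , _) = fs f0

Black-tail : ∀ r (j : Fin n) → Black (x ∷ g) (r , fs j) → Black g (r , j)
Black-tail f0     _ b = b
Black-tail (fs _) _ b = b

allEmpty-white : AllEmpty g → ∀ c → Black g c → ⊥
allEmpty-white {g = g} a (r , j) b =
  empty-white r (subst (λ x → rowColour r x ≡ true) (lookup⁺ a j) (Black-lookup g r j b))

shiftCell : Cell n → Cell (suc n)
shiftCell (r , j) = r , fs j

shiftAdj : ∀ {c d : Cell n} → Adj c d → Adj (shiftCell c) (shiftCell d)
shiftAdj (inj₁ (e , inj₁ p)) = inj₁ (e , inj₁ (cong suc p))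
shiftAdj (inj₁ (e , inj₂ p)) = inj₁ (e , inj₂ (cong suc p))
shiftAdj (inj₂ (e , r≢r′))   = inj₂ (cong fs e , r≢r′)

shiftPath : ∀ {c d} → Star (BlackStep g) c d → Star (BlackStep (x ∷ g)) (shiftCell c) (shiftCell d)
shiftPath {g = g} {x} = gmap shiftCell shiftStep
  where
  Black-shift : ∀ r (j : Fin _) → Black g (r , j) → Black (x ∷ g) (r , fs j)
  Black-shift f0     _ b = b
  Black-shift (fs _) _ b = b

  shiftStep : ∀ {c d} → BlackStep g c d → BlackStep (x ∷ g) (shiftCell c) (shiftCell d)
  shiftStep {r , j} {r′ , j′} (adj , bc , bd) = shiftAdj adj , Black-shift r j bc , Black-shift r′ j′ bd

reverseStep : ∀ {c d} → BlackStep g c d → BlackStep g d c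
reverseStep (inj₁ (e , inj₁ p) , bc , bd) = inj₁ (sym e , inj₂ p) , bd , bc
reverseStep (inj₁ (e , inj₂ p) , bc , bd) = inj₁ (sym e , inj₁ p) , bd , bc
reverseStep (inj₂ (e , r≢r′) , bc , bd)   = inj₂ (sym e , λ r′≡r → r≢r′ (sym r′≡r)) , bd , bc

pattern stepLeft          = inj₁ (refl , inj₂ refl) , refl , refl
pattern stepVertical r≢r′ = inj₂ (refl , r≢r′) , refl , refl

column-path : NonEmpty x → ∀ r → Black (x ∷ g) (r , f0) → Star (BlackStep (x ∷ g)) (r , f0) (anchor x , f0)
column-path ne-top    f0      _ = ε
column-path ne-top    (fs f0) ()
column-path ne-bottom f0      ()
column-path ne-bottom (fs f0) _ = ε
column-path ne-full   f0      _ = ε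
column-path ne-full   (fs f0) _ = stepVertical (λ ()) ◅ ε

link-path : ∀ r → NonEmpty y →
  Star (BlackStep (linkColumn r y ∷ y ∷ g)) (anchor y , fs f0) (anchor (linkColumn r y) , f0)
link-path f0      ne-top    = stepLeft ◅ ε
link-path f0      ne-bottom = stepLeft ◅ stepVertical (λ ()) ◅ ε
link-path f0      ne-full   = stepLeft ◅ ε
link-path (fs f0) ne-top    = stepLeft ◅ ε
link-path (fs f0) ne-bottom = stepLeft ◅ ε
link-path (fs f0) ne-full   = stepVertical (λ ()) ◅ stepLeft ◅ ε

strip-to-anchor : Strip x g → ∀ c → Black (x ∷ g) c → Star (BlackStep (x ∷ g)) c (anchor x , f0)
strip-to-anchor s (r , f0) b = column-path (strip-nonEmpty s) r b
strip-to-anchor (fullEnd a) (r , fs j) b = ⊥-elim (allEmpty-white a (r , j) (Black-tail r j b))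
strip-to-anchor (link _ (blanks a)) (r , fs j) b = ⊥-elim (allEmpty-white a (r , j) (Black-tail r j b))
strip-to-anchor (link r (strip s)) (r′ , fs j) b =
  shiftPath (strip-to-anchor s (r′ , j) (Black-tail r′ j b)) ◅◅ link-path r (strip-nonEmpty s)

strip-connected : Strip x g → BlackConnected (x ∷ g)
strip-connected s c d bc bd = strip-to-anchor s c bc ◅◅ Star-reverse reverseStep (strip-to-anchor s d bd)

shape-connected : NurikabeShape g → BlackConnected g
shape-connected (blank∷ _) (r , f0) _        bc _  = ⊥-elim (empty-white r (Black-lookup _ r f0 bc))
shape-connected (blank∷ _) _        (r , f0) _  bd = ⊥-elim (empty-white r (Black-lookup _ r f0 bd))
shape-connected (blank∷ s) (r , fs j) (r′ , fs j′) bc bd =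
  shiftPath (shape-connected s (r , j) (r′ , j′) (Black-tail r j bc) (Black-tail r′ j′ bd))
shape-connected (strip s) = strip-connected s

strip-no2x2 : Strip x (y ∷ g) → x ≡ full → y ≡ full → ⊥
strip-no2x2 (fullEnd (refl ∷ _))         _  ()
strip-no2x2 (link _ (blanks (refl ∷ _))) _  ()
strip-no2x2 (link f0 (strip _))      () refl
strip-no2x2 (link (fs f0) (strip _)) () refl

shape-tail : NurikabeShape (x ∷ g) → NurikabeShape g
shape-tail (blank∷ s)                  = s
shape-tail (strip (fullEnd a))         = allEmpty-shape a
shape-tail (strip (link _ (blanks a))) = allEmpty-shape a
shape-tail (strip (link _ (strip s)))  = strip s

shape-no2x2 : NurikabeShape g → No2x2Black g
shape-no2x2 (blank∷ _) f0 (fs f0) _ (() , _)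
shape-no2x2 {g = _ ∷ _ ∷ _} (strip s) f0 (fs f0) _ (bj₀ , bj₁ , bk₀ , bk₁) =
  strip-no2x2 s (cong₂ _,_ bj₀ bj₁) (cong₂ _,_ bk₀ bk₁)
shape-no2x2 {g = _ ∷ _} s (fs j) (fs k) k≡1+j = shape-no2x2 (shape-tail s) j k (suc-injective k≡1+j)

shape⇒nurikabe : NurikabeShape g → IsNurikabe g
shape⇒nurikabe s = shape-connected s , shape-no2x2 s

theorem11p3 : (m : ℕ) → NurikabeGrid (suc m) ⤖ 𝕊Set m
theorem11p3 m = ↔⇒⤖ (mk↔ₛ′ to from to∘from from∘to)
  where
  to : NurikabeGrid (suc m) → 𝕊Set m
  to (g , [ p ]) = encode false g , [ In𝕊⇒∈𝕊 m (encode-shape (nurikabe⇒shape p)) ]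

  from : 𝕊Set m → NurikabeGrid (suc m)
  from (s , [ q ]) = decode false s , [ shape⇒nurikabe (proj₁ (decode-in𝕊 (∈𝕊⇒In𝕊 m q))) ]

  -- The membership proofs are irrelevant, so the round-trip equations are
  -- recomputed by deciding equality of the underlying vectors.
  to∘from : ∀ s → to (from s) ≡ s
  to∘from (s , [ q ]) =
    value-injective (recompute (vec-≡-dec _≟ᶠ_ _ _) (proj₂ (decode-in𝕊 (∈𝕊⇒In𝕊 m q))))

  from∘to : ∀ g → from (to g) ≡ g
  from∘to (g , [ p ]) =
    value-injective (recompute (vec-≡-dec (×-≡-dec _≟ᵇ_ _≟ᵇ_) _ _) (decode-shape (nurikabe⇒shape p)))
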